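{- Let $m,n\ge2$, $a\in A$, and $u,v\in A^*$ with $u\equiv_{m,n}v$. If $u=u_-au_+$ and $v=v_-av_+$ are the $a$-left factorizations (i.e. $a\notin\mathsf{alph}(u_-)\cup\mathsf{alph}(v_-)$), then $u_-\equiv_{m-1,n-1}v_-$ and $u_+\equiv_{m,n-1}v_+$. Dually, if $u=u_-au_+$ and $v=v_-av_+$ are the $a$-right factorizations (i.e. $a\notin\mathsf{alph}(u_+)\cup\mathsf{alph}(v_+)$), then $u_+\equiv_{m-1,n-1}v_+$ and $u_-\equiv_{m,n-1}v_-$.
   Context: $A$ is a finite alphabet; $\mathsf{alph}(w)$ is the set of letters of $w$. Rankers: for $u=a_1\cdots a_k\in A^*$ and $x\in\{0,\dots,k+1\}$, $\mathsf X_a(u,x)=\min\{y:y>x,\ a_y=a\}$, $\mathsf Y_a(u,x)=\max\{y:y<x,\ a_y=a\}$ (undefined if the set is empty), $\mathsf X_a(u)=\mathsf X_a(u,0)$, $\mathsf Y_a(u)=\mathsf Y_a(u,k+1)$. A ranker is a nonempty word over $\{\mathsf X_a,\mathsf Y_a:a\in A\}$; for $r=\mathsf Zs$ with $\mathsf Z$ a single letter, $r(u,x)=s(u,\mathsf Z(u,x))$, $r(u)=s(u,\mathsf Z(u))$ (for a one-letter ranker $r(u)=\mathsf Z(u)$); a ranker defines one position of $u$ or is undefined. Depth = length; a block is a maximal factor of only $\mathsf X$-letters or only $\mathsf Y$-letters. $R_{m,n}$: rankers of depth $\le n$ with $\le m$ blocks; $R^{\mathsf X}_{m,n}$ (resp.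 $R^{\mathsf Y}_{m,n}$): those starting with an $\mathsf X_a$ (resp. $\mathsf Y_a$). $\mathrm{ord}(i,j)\in\{<,=,>\}$ is the order type of positions $i,j$. $u\equiv_{m,n}v$ iff (1) the same rankers of $R_{m,n}$ are defined on $u$ and $v$, and, whenever $r,s$ are defined, $\mathrm{ord}(r(u),s(u))=\mathrm{ord}(r(v),s(v))$ for (2) $r\in R^{\mathsf X}_{m,n}$, $s\in R^{\mathsf Y}_{m,n-1}$; (3) $r\in R^{\mathsf Y}_{m,n}$, $s\in R^{\mathsf X}_{m,n-1}$; (4) $r\in R^{\mathsf X}_{m,n}$, $s\in R^{\mathsf X}_{m-1,n-1}$; (5) $r\in R^{\mathsf Y}_{m,n}$, $s\in R^{\mathsf Y}_{m-1,n-1}$. -}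

module Defs where

open import Data.Nat using (ℕ; zero; suc; _≤_; _<ᵇ_; _∸_)
open import Data.Fin using (Fin) renaming (_≟_ to _≟ᶠ_)
open import Data.Bool using (Bool; true; false; if_then_else_; _∧_)
open import Data.List using (List; []; _∷_; length)
open import Data.List.NonEmpty using (List⁺; _∷_; toList)
open import Data.Maybe using (Maybe; just; nothing)
open import Data.Product using (Σ; _×_; ∃)
open import Data.Sum using (_⊎_)
open import Data.Unit using (⊤)
open import Data.Empty using (⊥)
open import Relation.Binary.PropositionalEquality using (_≡_)
open import Relation.Nullary.Decidable using (⌊_⌋)
open import Function.Bundles using (_⇔_)

Word : ℕ → Set
Word k = List (Fin k)

-- Positions of u = a₁⋯a_ℓ are 1,…,ℓ (with 0 and ℓ+1 as the sentinels).

-- X_a(u,x) = min { y | y > x, a_y = a }.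
-- Helper: scan w whose first letter is at position i.
nextFrom : ∀ {k} → Word k → Fin k → ℕ → ℕ → Maybe ℕ
nextFrom []       a i x = nothing
nextFrom (b ∷ w) a i x =
  if (x <ᵇ i) ∧ ⌊ b ≟ᶠ a ⌋ then just i else nextFrom w a (suc i) x

Xpos : ∀ {k} → Fin k → Word k → ℕ → Maybe ℕ
Xpos a u x = nextFrom u a 1 x

-- Y_a(u,x) = max { y | y < x, a_y = a }.
-- Helper: scan w whose first letter is at position i, acc = last hit so far.
prevFrom : ∀ {k} → Word k → Fin k → ℕ → ℕ → Maybe ℕ → Maybe ℕ
prevFrom []       a i x acc = acc
prevFrom (b ∷ w) a i x acc =
  prevFrom w a (suc i) x (if (i <ᵇ x) ∧ ⌊ b ≟ᶠ a ⌋ then just i else acc)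

Ypos : ∀ {k} → Fin k → Word k → ℕ → Maybe ℕ
Ypos a u x = prevFrom u a 1 x nothing

data Step (k : ℕ) : Set where
  X : Fin k → Step k
  Y : Fin k → Step k

applyStep : ∀ {k} → Step k → Word k → ℕ → Maybe ℕ
applyStep (X a) u x = Xpos a u x
applyStep (Y a) u x = Ypos a u x

Ranker : ℕ → Set
Ranker k = List⁺ (Step k)

runFrom : ∀ {k} → List (Step k) → Word k → ℕ → Maybe ℕ
runFrom []       u x = just x
runFrom (z ∷ zs) u x with applyStep z u x
... | nothing = nothing
... | just y  = runFrom zs u y

startPos : ∀ {k} → Step k → Word k → ℕ
startPos (X _) u = 0
startPos (Y _) u = suc (length u)

eval : ∀ {k} → Ranker k → Word k → Maybe ℕ
eval (z ∷ zs) u = runFrom (z ∷ zs) u (startPos z u)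

Defined : ∀ {k} → Ranker k → Word k → Set
Defined r u = ∃ λ p → eval r u ≡ just p

depth : ∀ {k} → Ranker k → ℕ
depth r = length (toList r)

sameDir : ∀ {k} → Step k → Step k → Bool
sameDir (X _) (X _) = true
sameDir (Y _) (Y _) = true
sameDir _     _     = false

blocksAux : ∀ {k} → Step k → List (Step k) → ℕ
blocksAux z []        = 1
blocksAux z (z' ∷ zs) = if sameDir z z' then blocksAux z' zs else suc (blocksAux z' zs)

blocks : ∀ {k} → Ranker k → ℕ
blocks (z ∷ zs) = blocksAux z zs

InR : ∀ {k} → ℕ → ℕ → Ranker k → Set
InR m n r = (depth r ≤ n) × (blocks r ≤ m)

StartsX : ∀ {k} → Ranker k → Set
StartsX (X _ ∷ _) = ⊤
StartsX (Y _ ∷ _) = ⊥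

StartsY : ∀ {k} → Ranker k → Set
StartsY (X _ ∷ _) = ⊥
StartsY (Y _ ∷ _) = ⊤

InRX : ∀ {k} → ℕ → ℕ → Ranker k → Set
InRX m n r = InR m n r × StartsX r

InRY : ∀ {k} → ℕ → ℕ → Ranker k → Set
InRY m n r = InR m n r × StartsY r

data Ord : Set where
  lt eq gt : Ord

ord : ℕ → ℕ → Ord
ord i j = if i <ᵇ j then lt else (if j <ᵇ i then gt else eq)

SameOrd : ∀ {k} → Ranker k → Ranker k → Word k → Word k → Set
SameOrd r s u v = ∀ {i j i' j'} →
  eval r u ≡ just i → eval s u ≡ just j →
  eval r v ≡ just i' → eval s v ≡ just j' →
  ord i j ≡ ord i' j'

record Equiv {k : ℕ} (m n : ℕ) (u v : Word k) : Set where
  field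
    cond1 : ∀ r → InR m n r → (Defined r u ⇔ Defined r v)
    cond2 : ∀ r s → InRX m n r → InRY m (n ∸ 1) s → SameOrd r s u v
    cond3 : ∀ r s → InRY m n r → InRX m (n ∸ 1) s → SameOrd r s u v
    cond4 : ∀ r s → InRX m n r → InRX (m ∸ 1) (n ∸ 1) s → SameOrd r s u v
    cond5 : ∀ r s → InRY m n r → InRY (m ∸ 1) (n ∸ 1) s → SameOrd r s u v

-- Let p be the position of the marker a (X_a(u) for the left factorization, Y_a(u) for the right
-- one).  A ranker on the factor of u on one side of p is simulated on u by the same ranker, prefixed
-- with the marker when its first step would start at p; it is defined on the factor exactly when
-- this run on u stays on that side of p.  Staying on a side of p means ord(ρ(u), p) is fixed for
-- every prefix ρ of the simulated ranker, and u ≡_{m,n} v transports this to v because the marker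
-- has depth 1 and one block.  Simulation costs one step and at most one block, so (m, n) on the
-- words gives (m-1, n-1) on the factors; when the marker continues the first block of the
-- simulated rankers (X_a on the right of p, Y_a on the left of p) no block is added and (m, n-1)
-- survives.

module Submission where

open import Defs
open import Data.Nat using (ℕ; zero; suc; _+_; _≤_; _<_; _∸_; _<ᵇ_; z≤n; s≤s)
open import Data.Nat.Properties
  using (<ᵇ-reflects-<; <ᵇ⇒<; <⇒<ᵇ; ≤-refl; ≤-trans; ≤-<-trans; <⇒≤; <⇒≱; <⇒≯; ≤-pred; m≤n⇒m≤1+n; n≤1+n;
         m≤m+n; m<m+n; +-monoʳ-≤; +-suc; +-identityʳ; +-comm; m+n∸m≡n; 0∸n≡0; m∸n≤m)
open import Data.Fin using (Fin; _≟_)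
open import Data.Bool using (true; false; if_then_else_; _∧_)
open import Data.Bool.Properties using (∧-zeroʳ; ∧-conicalˡ; T-≡)
open import Data.List using (List; []; _∷_; _++_; length)
open import Data.List.Properties using (length-++; ++-assoc)
open import Data.List.NonEmpty using (_∷_; toList; head)
open import Data.List.Membership.Propositional using (_∉_)
open import Data.List.Relation.Unary.Any using (here; there)
open import Data.Maybe using (Maybe; just; nothing; map; _<∣>_; _>>=_)
open import Data.Product using (_×_; _,_; proj₁; proj₂; ∃)
open import Data.Sum using (_⊎_; inj₁; inj₂)
open import Data.Unit using (⊤; tt)
open import Data.Empty using (⊥)
open import Function using (_∘_)
open import Function.Bundles using (_⇔_; mk⇔; Equivalence)
open import Relation.Binary.PropositionalEquality
open import Relation.Nullary using (contradiction; yes; no)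
open import Relation.Nullary.Decidable using (⌊_⌋)
open import Relation.Nullary.Reflects using (ofʸ; ofⁿ)

ord-< : ∀ {i j} → i < j → ord i j ≡ lt
ord-< {i} {j} i<j with i <ᵇ j | <ᵇ-reflects-< i j
... | true  | _       = refl
... | false | ofⁿ i≮j = contradiction i<j i≮j

ord-> : ∀ {i j} → j < i → ord i j ≡ gt
ord-> {i} {j} j<i with i <ᵇ j | <ᵇ-reflects-< i j | j <ᵇ i | <ᵇ-reflects-< j i
... | true  | ofʸ i<j | _     | _       = contradiction i<j (<⇒≯ j<i)
... | false | _       | true  | _       = refl
... | false | _       | false | ofⁿ j≮i = contradiction j<i j≮i

ord≡lt⇒< : ∀ i j → ord i j ≡ lt → i < j
ord≡lt⇒< i j with i <ᵇ j | <ᵇ-reflects-< i j | j <ᵇ i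
... | true  | ofʸ i<j | _     = λ _ → i<j
... | false | _       | true  = λ ()
... | false | _       | false = λ ()

ord≡gt⇒> : ∀ i j → ord i j ≡ gt → j < i
ord≡gt⇒> i j with i <ᵇ j | j <ᵇ i | <ᵇ-reflects-< j i
... | true  | _     | _       = λ ()
... | false | true  | ofʸ j<i = λ _ → j<i
... | false | false | _       = λ ()

ord-+ : ∀ L i j → ord (L + i) (L + j) ≡ ord i j
ord-+ zero    i j = refl
ord-+ (suc L) i j = ord-+ L i j

reverseOrd : Ord → Ord
reverseOrd lt = gt
reverseOrd eq = eq
reverseOrd gt = lt

ord-swap : ∀ i j → ord j i ≡ reverseOrd (ord i j)
ord-swap i j with i <ᵇ j | <ᵇ-reflects-< i j | j <ᵇ i | <ᵇ-reflects-< j i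
... | true  | ofʸ i<j | true  | ofʸ j<i = contradiction i<j (<⇒≯ j<i)
... | true  | _       | false | _       = refl
... | false | _       | true  | _       = refl
... | false | _       | false | _       = refl

-- Scanning a concatenation

<ᵇ-shiftʳ : ∀ L x i → (x <ᵇ L + suc i) ≡ (x ∸ L <ᵇ suc i)
<ᵇ-shiftʳ zero    x       i = refl
<ᵇ-shiftʳ (suc L) zero    i = refl
<ᵇ-shiftʳ (suc L) (suc x) i = <ᵇ-shiftʳ L x i

<ᵇ-shiftˡ : ∀ L i x → (L + i <ᵇ x) ≡ (i <ᵇ x ∸ L)
<ᵇ-shiftˡ zero    i x       = refl
<ᵇ-shiftˡ (suc L) i zero    = refl
<ᵇ-shiftˡ (suc L) i (suc x) = <ᵇ-shiftˡ L i x

nextFrom-++ : ∀ {k} (w t : Word k) b i x →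
  nextFrom (w ++ t) b i x ≡ (nextFrom w b i x <∣> nextFrom t b (length w + i) x)
nextFrom-++ []      t b i x = refl
nextFrom-++ (c ∷ w) t b i x with (x <ᵇ i) ∧ ⌊ c ≟ b ⌋
... | true  = refl
... | false = trans (nextFrom-++ w t b (suc i) x)
                (cong (λ j → nextFrom w b (suc i) x <∣> nextFrom t b j x) (+-suc (length w) i))

nextFrom-shift : ∀ {k} (t : Word k) b L i x →
  nextFrom t b (L + suc i) x ≡ map (L +_) (nextFrom t b (suc i) (x ∸ L))
nextFrom-shift []      b L i x = refl
nextFrom-shift (c ∷ t) b L i x rewrite <ᵇ-shiftʳ L x i with (x ∸ L <ᵇ suc i) ∧ ⌊ c ≟ b ⌋
... | true  = refl
... | false = trans (cong (λ j → nextFrom t b j x) (sym (+-suc L (suc i)))) (nextFrom-shift t b L (suc i) x)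

Xpos-++ : ∀ {k} (w t : Word k) b x →
  Xpos b (w ++ t) x ≡ (Xpos b w x <∣> map (length w +_) (Xpos b t (x ∸ length w)))
Xpos-++ w t b x = trans (nextFrom-++ w t b 1 x) (cong (Xpos b w x <∣>_) (nextFrom-shift t b (length w) 0 x))

prevFrom-++ : ∀ {k} (w t : Word k) b i x acc →
  prevFrom (w ++ t) b i x acc ≡ prevFrom t b (length w + i) x (prevFrom w b i x acc)
prevFrom-++ []      t b i x acc = refl
prevFrom-++ (c ∷ w) t b i x acc =
  trans (prevFrom-++ w t b (suc i) x _)
        (cong (λ j → prevFrom t b j x (prevFrom (c ∷ w) b i x acc)) (+-suc (length w) i))

prevFrom-acc : ∀ {k} (t : Word k) b i x acc → prevFrom t b i x acc ≡ (prevFrom t b i x nothing <∣> acc)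
prevFrom-acc []      b i x acc = refl
prevFrom-acc (c ∷ t) b i x acc with (i <ᵇ x) ∧ ⌊ c ≟ b ⌋
... | false = prevFrom-acc t b (suc i) x acc
... | true rewrite prevFrom-acc t b (suc i) x (just i) with prevFrom t b (suc i) x nothing
...   | just y  = refl
...   | nothing = refl

prevFrom-shift : ∀ {k} (t : Word k) b L i x acc →
  prevFrom t b (L + i) x (map (L +_) acc) ≡ map (L +_) (prevFrom t b i (x ∸ L) acc)
prevFrom-shift []      b L i x acc = refl
prevFrom-shift (c ∷ t) b L i x acc rewrite <ᵇ-shiftˡ L i x with (i <ᵇ x ∸ L) ∧ ⌊ c ≟ b ⌋
... | true  = trans (cong (λ j → prevFrom t b j x (just (L + i))) (sym (+-suc L i)))
                    (prevFrom-shift t b L (suc i) x (just i))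
... | false = trans (cong (λ j → prevFrom t b j x (map (L +_) acc)) (sym (+-suc L i)))
                    (prevFrom-shift t b L (suc i) x acc)

Ypos-++ : ∀ {k} (w t : Word k) b x →
  Ypos b (w ++ t) x ≡ (map (length w +_) (Ypos b t (x ∸ length w)) <∣> Ypos b w x)
Ypos-++ w t b x =
  trans (prevFrom-++ w t b 1 x nothing)
  (trans (prevFrom-acc t b (length w + 1) x (Ypos b w x))
         (cong (_<∣> Ypos b w x) (prevFrom-shift t b (length w) 1 x nothing)))

nextFrom-bounds : ∀ {k} (w : Word k) b i x {y} → nextFrom w b i x ≡ just y → x < y × y < i + length w
nextFrom-bounds []      b i x ()
nextFrom-bounds (c ∷ w) b i x e with (x <ᵇ i) ∧ ⌊ c ≟ b ⌋ in hit
... | true with e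
...   | refl = <ᵇ⇒< x i (Equivalence.from T-≡ (∧-conicalˡ _ _ hit)) , m<m+n i (s≤s z≤n)
nextFrom-bounds (c ∷ w) b i x {y} e | false with nextFrom-bounds w b (suc i) x e
...   | x<y , y< = x<y , subst (y <_) (sym (+-suc i (length w))) y<

Xpos-bounds : ∀ {k} (w : Word k) b x {y} → Xpos b w x ≡ just y → x < y × y ≤ length w
Xpos-bounds w b x e with nextFrom-bounds w b 1 x e
... | x<y , y<1+w = x<y , ≤-pred y<1+w

prevFrom-bounds : ∀ {k} (w : Word k) b i x acc {y} → prevFrom w b i x acc ≡ just y →
  acc ≡ just y ⊎ (y < x × i ≤ y × y < i + length w)
prevFrom-bounds []      b i x acc e = inj₁ e
prevFrom-bounds (c ∷ w) b i x acc {y} e with (i <ᵇ x) ∧ ⌊ c ≟ b ⌋ in hit | prevFrom-bounds w b (suc i) x _ e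
... | true  | inj₁ refl = inj₂ (<ᵇ⇒< i x (Equivalence.from T-≡ (∧-conicalˡ _ _ hit)) , ≤-refl , m<m+n i (s≤s z≤n))
... | false | inj₁ acc≡ = inj₁ acc≡
... | _     | inj₂ (y<x , i<y , y<) = inj₂ (y<x , <⇒≤ i<y , subst (y <_) (sym (+-suc i (length w))) y<)

Ypos-bounds : ∀ {k} (w : Word k) b x {y} → Ypos b w x ≡ just y → y < x × 0 < y × y ≤ length w
Ypos-bounds w b x e with prevFrom-bounds w b 1 x nothing e
... | inj₂ (y<x , 0<y , y<1+w) = y<x , 0<y , ≤-pred y<1+w

Xpos-beyond : ∀ {k} (t : Word k) b {x} → length t ≤ x → Xpos b t x ≡ nothing
Xpos-beyond t b {x} t≤x with Xpos b t x in e
... | nothing = refl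
... | just y with Xpos-bounds t b x e
...   | x<y , y≤t = contradiction (≤-trans y≤t t≤x) (<⇒≱ x<y)

Ypos-before-start : ∀ {k} (t : Word k) b {x} → x ≤ 1 → Ypos b t x ≡ nothing
Ypos-before-start t b {x} x≤1 with Ypos b t x in e
... | nothing = refl
... | just y with Ypos-bounds t b x e
...   | y<x , 0<y , _ = contradiction (≤-pred (≤-trans y<x x≤1)) (<⇒≱ 0<y)

applyStep-pos : ∀ {k} z (t : Word k) x {y} → applyStep z t x ≡ just y → 0 < y
applyStep-pos (X b) t x e = ≤-<-trans z≤n (proj₁ (Xpos-bounds t b x e))
applyStep-pos (Y b) t x e = proj₁ (proj₂ (Ypos-bounds t b x e))

nextFrom-∉ : ∀ {k} (w : Word k) a i x → a ∉ w → nextFrom w a i x ≡ nothing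
nextFrom-∉ []      a i x a∉w = refl
nextFrom-∉ (c ∷ w) a i x a∉w with c ≟ a
... | yes refl = contradiction (here refl) a∉w
... | no _ rewrite ∧-zeroʳ (x <ᵇ i) = nextFrom-∉ w a (suc i) x (a∉w ∘ there)

prevFrom-∉ : ∀ {k} (w : Word k) a i x acc → a ∉ w → prevFrom w a i x acc ≡ acc
prevFrom-∉ []      a i x acc a∉w = refl
prevFrom-∉ (c ∷ w) a i x acc a∉w with c ≟ a
... | yes refl = contradiction (here refl) a∉w
... | no _ rewrite ∧-zeroʳ (i <ᵇ x) = prevFrom-∉ w a (suc i) x acc (a∉w ∘ there)

<∣>-just : ∀ (mx my : Maybe ℕ) {y} → (mx <∣> my) ≡ just y → mx ≡ just y ⊎ my ≡ just y
<∣>-just (just x) my e = inj₁ e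
<∣>-just nothing  my e = inj₂ e

map-just : ∀ (f : ℕ → ℕ) (mx : Maybe ℕ) {y} → map f mx ≡ just y → ∃ λ x → y ≡ f x × mx ≡ just x
map-just f (just x) refl = x , refl , refl

m≤1+n⇒m∸n≤1 : ∀ n m → m ≤ suc n → m ∸ n ≤ 1
m≤1+n⇒m∸n≤1 zero    m       m≤       = m≤
m≤1+n⇒m∸n≤1 (suc n) zero    _        = z≤n
m≤1+n⇒m∸n≤1 (suc n) (suc m) (s≤s m≤) = m≤1+n⇒m∸n≤1 n m m≤

Ypos-++ˡ : ∀ {k} (w t : Word k) b {x} → x ≤ suc (length w) → Ypos b (w ++ t) x ≡ Ypos b w x
Ypos-++ˡ w t b {x} x≤ rewrite Ypos-++ w t b x | Ypos-before-start t b (m≤1+n⇒m∸n≤1 (length w) x x≤) = refl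

prefix-step : ∀ {k} z (w t : Word k) {x y} → x ≤ suc (length w) →
  applyStep z w x ≡ just y → y ≤ length w × applyStep z (w ++ t) x ≡ just y
prefix-step (X b) w t {x} x≤ e rewrite Xpos-++ w t b x | e = proj₂ (Xpos-bounds w b x e) , refl
prefix-step (Y b) w t {x} x≤ e rewrite Ypos-++ˡ w t b x≤ = proj₂ (proj₂ (Ypos-bounds w b x e)) , e

prefix-step⁻ : ∀ {k} z (w t : Word k) {x y} → x ≤ suc (length w) →
  applyStep z (w ++ t) x ≡ just y → y ≤ length w → applyStep z w x ≡ just y
prefix-step⁻ (Y b) w t x≤ e y≤w = trans (sym (Ypos-++ˡ w t b x≤)) e
prefix-step⁻ (X b) w t {x} x≤ e y≤w with <∣>-just (Xpos b w x) _ (trans (sym (Xpos-++ w t b x)) e)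
... | inj₁ e′ = e′
... | inj₂ e′ with map-just (length w +_) (Xpos b t (x ∸ length w)) e′
...   | y′ , refl , e″ = contradiction y≤w (<⇒≱ (m<m+n (length w) (applyStep-pos (X b) t (x ∸ length w) e″)))

Xpos-++ʳ : ∀ {k} (s t : Word k) b x → Xpos b (s ++ t) (length s + x) ≡ map (length s +_) (Xpos b t x)
Xpos-++ʳ s t b x rewrite Xpos-++ s t b (length s + x) | Xpos-beyond s b (m≤m+n (length s) x)
  | m+n∸m≡n (length s) x = refl

Ypos-++ʳ : ∀ {k} (s t : Word k) b x →
  Ypos b (s ++ t) (length s + x) ≡ (map (length s +_) (Ypos b t x) <∣> Ypos b s (length s + x))
Ypos-++ʳ s t b x rewrite Ypos-++ s t b (length s + x) | m+n∸m≡n (length s) x = refl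

suffix-step : ∀ {k} z (s t : Word k) {x y} →
  applyStep z t x ≡ just y → applyStep z (s ++ t) (length s + x) ≡ just (length s + y)
suffix-step (X b) s t {x} e rewrite Xpos-++ʳ s t b x | e = refl
suffix-step (Y b) s t {x} e rewrite Ypos-++ʳ s t b x | e = refl

suffix-step⁻ : ∀ {k} z (s t : Word k) {x y} → applyStep z (s ++ t) (length s + x) ≡ just y →
  length s < y → ∃ λ y′ → y ≡ length s + y′ × applyStep z t x ≡ just y′
suffix-step⁻ (X b) s t {x} e s<y = map-just (length s +_) _ (trans (sym (Xpos-++ʳ s t b x)) e)
suffix-step⁻ (Y b) s t {x} e s<y with <∣>-just (map (length s +_) (Ypos b t x)) _ (trans (sym (Ypos-++ʳ s t b x)) e)
... | inj₁ e′ = map-just (length s +_) _ e′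
... | inj₂ e′ = contradiction (proj₂ (proj₂ (Ypos-bounds s b _ e′))) (<⇒≱ s<y)

-- Runs confined to one side of a marker

runFrom-single : ∀ {k} (z : Step k) u x → runFrom (z ∷ []) u x ≡ applyStep z u x
runFrom-single z u x with applyStep z u x
... | nothing = refl
... | just y  = refl

runFrom-++ : ∀ {k} (l l′ : List (Step k)) u x → runFrom (l ++ l′) u x ≡ (runFrom l u x >>= runFrom l′ u)
runFrom-++ []      l′ u x = refl
runFrom-++ (z ∷ l) l′ u x with applyStep z u x
... | nothing = refl
... | just y  = runFrom-++ l l′ u y

eval-snoc : ∀ {k} (h : Step k) pre z u {x} → eval (h ∷ pre) u ≡ just x →
  eval (h ∷ pre ++ z ∷ []) u ≡ applyStep z u x
eval-snoc h pre z u {x} e = begin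
  runFrom ((h ∷ pre) ++ z ∷ []) u (startPos h u)       ≡⟨ runFrom-++ (h ∷ pre) (z ∷ []) u (startPos h u) ⟩
  (eval (h ∷ pre) u >>= runFrom (z ∷ []) u)            ≡⟨ cong (_>>= runFrom (z ∷ []) u) e ⟩
  runFrom (z ∷ []) u x                                 ≡⟨ runFrom-single z u x ⟩
  applyStep z u x                                      ∎
  where open ≡-Reasoning

Within : ∀ {k} → (ℕ → Set) → List (Step k) → Word k → ℕ → Set
Within P []       u x = ⊤
Within P (z ∷ zs) u x = ∃ λ y → applyStep z u x ≡ just y × P y × Within P zs u y

data Side : Set where
  before after : Side

sideOrd : Side → Ord
sideOrd before = lt
sideOrd after  = gt

OnSide : Side → ℕ → ℕ → Set
OnSide side p y = ord y p ≡ sideOrd side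

-- A ranker of the factor on the given side of M(u), read on u: it is prefixed with M when its first
-- step would start at the marker.
anchor : ∀ {k} → Side → Step k → Ranker k → Ranker k
anchor before M (X b ∷ zs) = X b ∷ zs
anchor before M (Y b ∷ zs) = M ∷ Y b ∷ zs
anchor after  M (X b ∷ zs) = M ∷ X b ∷ zs
anchor after  M (Y b ∷ zs) = Y b ∷ zs

entry : ∀ {k} → Side → ℕ → Word k → Ranker k → ℕ
entry before p u (X _ ∷ _) = 0
entry before p u (Y _ ∷ _) = p
entry after  p u (X _ ∷ _) = p
entry after  p u (Y _ ∷ _) = suc (length u)

Stays : ∀ {k} → Side → ℕ → Word k → Ranker k → Set
Stays side p u r = Within (OnSide side p) (toList r) u (entry side p u r)

eval-anchor : ∀ {k} side (M : Step k) r u {p} → eval (M ∷ []) u ≡ just p →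
  eval (anchor side M r) u ≡ runFrom (toList r) u (entry side p u r)
eval-anchor before M (X b ∷ zs) u e = refl
eval-anchor before M (Y b ∷ zs) u e = trans (runFrom-++ (M ∷ []) (Y b ∷ zs) u _) (cong (_>>= runFrom (Y b ∷ zs) u) e)
eval-anchor after  M (X b ∷ zs) u e = trans (runFrom-++ (M ∷ []) (X b ∷ zs) u _) (cong (_>>= runFrom (X b ∷ zs) u) e)
eval-anchor after  M (Y b ∷ zs) u e = refl

record Window {k} (side : Side) (M : Step k) (u w : Word k) : Set where
  field
    mark      : ℕ
    offset    : ℕ
    mark-eval : eval (M ∷ []) u ≡ just mark
    embed     : ∀ r {y} → eval r w ≡ just y → Stays side mark u r × eval (anchor side M r) u ≡ just (offset + y)
    restrict  : ∀ r → Stays side mark u r → Defined r w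

-- w sits in u at offset L; Dom is an invariant of the positions of w visited by runs.
module Simulation {k} {w u : Word k} (side : Side) (p L : ℕ) (Dom : ℕ → Set)
  (step-sim : ∀ z {x y} → Dom x → applyStep z w x ≡ just y →
              Dom y × OnSide side p (L + y) × applyStep z u (L + x) ≡ just (L + y))
  (step-sim⁻ : ∀ z {x y} → Dom x → applyStep z u (L + x) ≡ just y → OnSide side p y →
               ∃ λ y′ → y ≡ L + y′ × Dom y′ × applyStep z w x ≡ just y′)
  where

  run-sim : ∀ zs {x y} → Dom x → runFrom zs w x ≡ just y →
    Within (OnSide side p) zs u (L + x) × runFrom zs u (L + x) ≡ just (L + y)
  run-sim []       dx refl = tt , refl
  run-sim (z ∷ zs) {x} dx e with applyStep z w x in ez
  ... | just y₁ with step-sim z dx ez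
  ...   | dy₁ , on₁ , ez′ with run-sim zs dy₁ e
  ...     | within , e′ rewrite ez′ = (L + y₁ , refl , on₁ , within) , e′

  run-sim⁻ : ∀ zs {x} → Dom x → Within (OnSide side p) zs u (L + x) → ∃ λ y → runFrom zs w x ≡ just y
  run-sim⁻ []       {x} dx _ = x , refl
  run-sim⁻ (z ∷ zs) dx (y , e , on , within) with step-sim⁻ z dx e on
  ... | y′ , refl , dy′ , e′ rewrite e′ = run-sim⁻ zs dy′ within

  toWindow : (M : Step k) → eval (M ∷ []) u ≡ just p →
    (∀ z zs → entry side p u (z ∷ zs) ≡ L + startPos z w) → (∀ z → Dom (startPos z w)) → Window side M u w
  toWindow M Mu entry≡ dom-start = record
    { mark = p ; offset = L ; mark-eval = Mu ; embed = embed ; restrict = restrict }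
    where
    embed : ∀ r {y} → eval r w ≡ just y → Stays side p u r × eval (anchor side M r) u ≡ just (L + y)
    embed (z ∷ zs) e with run-sim (z ∷ zs) (dom-start z) e
    ... | within , e′ rewrite eval-anchor side M (z ∷ zs) u Mu | entry≡ z zs = within , e′

    restrict : ∀ r → Stays side p u r → Defined r w
    restrict (z ∷ zs) stays = run-sim⁻ (z ∷ zs) (dom-start z) (subst (Within _ (z ∷ zs) u) (entry≡ z zs) stays)

prefix-window : ∀ {k} (M : Step k) (w t : Word k) → eval (M ∷ []) (w ++ t) ≡ just (suc (length w)) →
  Window before M (w ++ t) w
prefix-window M w t Mu = toWindow M Mu (λ { (X _) _ → refl ; (Y _) _ → refl }) (λ { (X _) → z≤n ; (Y _) → ≤-refl })
  where
  Dom : ℕ → Set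
  Dom x = x ≤ suc (length w)

  sim : ∀ z {x y} → Dom x → applyStep z w x ≡ just y →
        Dom y × OnSide before (suc (length w)) y × applyStep z (w ++ t) x ≡ just y
  sim z x≤ e with prefix-step z w t x≤ e
  ... | y≤w , e′ = m≤n⇒m≤1+n y≤w , ord-< (s≤s y≤w) , e′

  sim⁻ : ∀ z {x y} → Dom x → applyStep z (w ++ t) x ≡ just y → OnSide before (suc (length w)) y →
         ∃ λ y′ → y ≡ y′ × Dom y′ × applyStep z w x ≡ just y′
  sim⁻ z {y = y} x≤ e on with ord≡lt⇒< y (suc (length w)) on
  ... | s≤s y≤w = _ , refl , m≤n⇒m≤1+n y≤w , prefix-step⁻ z w t x≤ e y≤w

  open Simulation before (suc (length w)) 0 Dom sim sim⁻

suffix-window : ∀ {k} (M : Step k) (s t : Word k) → eval (M ∷ []) (s ++ t) ≡ just (length s) →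
  Window after M (s ++ t) t
suffix-window M s t Mu = toWindow M Mu entry≡ (λ _ → tt)
  where
  sim : ∀ z {x y} → ⊤ → applyStep z t x ≡ just y →
        ⊤ × OnSide after (length s) (length s + y) × applyStep z (s ++ t) (length s + x) ≡ just (length s + y)
  sim z _ e = tt , ord-> (m<m+n (length s) (applyStep-pos z t _ e)) , suffix-step z s t e

  sim⁻ : ∀ z {x y} → ⊤ → applyStep z (s ++ t) (length s + x) ≡ just y → OnSide after (length s) y →
         ∃ λ y′ → y ≡ length s + y′ × ⊤ × applyStep z t x ≡ just y′
  sim⁻ z _ e on with suffix-step⁻ z s t e (ord≡gt⇒> _ _ on)
  ... | y′ , y≡ , e′ = y′ , y≡ , tt , e′

  entry≡ : ∀ z zs → entry after (length s) (s ++ t) (z ∷ zs) ≡ length s + startPos z t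
  entry≡ (X _) _ = sym (+-identityʳ (length s))
  entry≡ (Y _) _ = trans (cong suc (length-++ s)) (sym (+-suc (length s) (length t)))

  open Simulation after (length s) (length s) (λ _ → ⊤) sim sim⁻

suffix-window-∷ : ∀ {k} (M : Step k) (w : Word k) c t → eval (M ∷ []) (w ++ c ∷ t) ≡ just (suc (length w)) →
  Window after M (w ++ c ∷ t) t
suffix-window-∷ M w c t Mu =
  subst (λ u → Window after M u t) (++-assoc w (c ∷ []) t) (suffix-window M (w ++ c ∷ []) t Mu′)
  where
  Mu′ : eval (M ∷ []) ((w ++ c ∷ []) ++ t) ≡ just (length (w ++ c ∷ []))
  Mu′ = subst₂ (λ u p → eval (M ∷ []) u ≡ just p) (sym (++-assoc w (c ∷ []) t))
               (sym (trans (length-++ w) (+-comm (length w) 1))) Mu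

-- Anchored rankers and the order conditions of ≡_{m,n}

blocksAux-pos : ∀ {k} (z : Step k) zs → 1 ≤ blocksAux z zs
blocksAux-pos z []        = s≤s z≤n
blocksAux-pos z (z′ ∷ zs) with sameDir z z′
... | true  = blocksAux-pos z′ zs
... | false = s≤s z≤n

blocksAux-++ : ∀ {k} (z : Step k) l l′ → blocksAux z l ≤ blocksAux z (l ++ l′)
blocksAux-++ z []        l′ = blocksAux-pos z l′
blocksAux-++ z (z′ ∷ l) l′ with sameDir z z′
... | true  = blocksAux-++ z′ l l′
... | false = s≤s (blocksAux-++ z′ l l′)

blocksAux-∷ : ∀ {k} (M z : Step k) zs → blocksAux M (z ∷ zs) ≤ suc (blocksAux z zs)
blocksAux-∷ M z zs with sameDir M z
... | true  = n≤1+n _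
... | false = ≤-refl

InR-mono : ∀ {k m n m′ n′} (r : Ranker k) → m ≤ m′ → n ≤ n′ → InR m n r → InR m′ n′ r
InR-mono r m≤ n≤ (d , b) = ≤-trans d n≤ , ≤-trans b m≤

InR-prefix : ∀ {k m n} (h : Step k) l l′ → InR m n (h ∷ l ++ l′) → InR m n (h ∷ l)
InR-prefix h l l′ (d , b) =
  ≤-trans (s≤s (subst (length l ≤_) (sym (length-++ l)) (m≤m+n _ _))) d , ≤-trans (blocksAux-++ h l l′) b

InR-reassoc : ∀ {k m n} (h : Step k) pre z zs → InR m n (h ∷ pre ++ z ∷ zs) → InR m n (h ∷ (pre ++ z ∷ []) ++ zs)
InR-reassoc {m = m} {n} h pre z zs = subst (λ l → InR m n (h ∷ l)) (sym (++-assoc pre (z ∷ []) zs))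

anchor-InR : ∀ {k m n} side (M : Step k) r → InR m n r → InR (suc m) (suc n) (anchor side M r)
anchor-InR before M r@(X _ ∷ _)  r∈      = InR-mono r (n≤1+n _) (n≤1+n _) r∈
anchor-InR before M (Y c ∷ zs)   (d , b) = s≤s d , ≤-trans (blocksAux-∷ M (Y c) zs) (s≤s b)
anchor-InR after  M (X c ∷ zs)   (d , b) = s≤s d , ≤-trans (blocksAux-∷ M (X c) zs) (s≤s b)
anchor-InR after  M r@(Y _ ∷ _)  r∈      = InR-mono r (n≤1+n _) (n≤1+n _) r∈

-- The marker continues the first block of every ranker it is prefixed to.
data Aligned {k} : Side → Step k → Set where
  before-Y : ∀ c → Aligned before (Y c)
  after-X  : ∀ c → Aligned after (X c)

anchor-InR-aligned : ∀ {k m n side} {M : Step k} → Aligned side M → ∀ r → InR m n r → InR m (suc n) (anchor side M r)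
anchor-InR-aligned (before-Y c) r@(X _ ∷ _) r∈      = InR-mono r ≤-refl (n≤1+n _) r∈
anchor-InR-aligned (before-Y c) (Y _ ∷ _)   (d , b) = s≤s d , b
anchor-InR-aligned (after-X c)  (X _ ∷ _)   (d , b) = s≤s d , b
anchor-InR-aligned (after-X c)  r@(Y _ ∷ _) r∈      = InR-mono r ≤-refl (n≤1+n _) r∈

Opposite : ∀ {k} → Step k → Step k → Set
Opposite (X _) (X _) = ⊥
Opposite (X _) (Y _) = ⊤
Opposite (Y _) (X _) = ⊤
Opposite (Y _) (Y _) = ⊥

Opposite-anchor-aligned : ∀ {k side} {M : Step k} → Aligned side M → ∀ r s →
  Opposite (head r) (head s) → Opposite (head (anchor side M r)) (head (anchor side M s))
Opposite-anchor-aligned (before-Y c) (X _ ∷ _) (Y _ ∷ _) _ = tt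
Opposite-anchor-aligned (before-Y c) (Y _ ∷ _) (X _ ∷ _) _ = tt
Opposite-anchor-aligned (after-X c)  (X _ ∷ _) (Y _ ∷ _) _ = tt
Opposite-anchor-aligned (after-X c)  (Y _ ∷ _) (X _ ∷ _) _ = tt

-- The pairs whose relative order conditions (2)–(5) of ≡_{m,n} prescribe.
Comparable : ∀ {k} → ℕ → ℕ → Ranker k → Ranker k → Set
Comparable m n r s = InR m n r × (InR (m ∸ 1) (n ∸ 1) s ⊎ InR m (n ∸ 1) s × Opposite (head r) (head s))

anchor-Comparable : ∀ {k m n} side (M : Step k) r s → Comparable (suc m) (suc n) r s →
  Comparable (suc (suc m)) (suc (suc n)) (anchor side M r) (anchor side M s) ⊎
  Comparable (suc (suc m)) (suc (suc n)) (anchor side M s) (anchor side M r)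
anchor-Comparable side M r s (r∈ , inj₁ s∈) = inj₁ (anchor-InR side M r r∈ , inj₁ (anchor-InR side M s s∈))
anchor-Comparable before M r@(X _ ∷ _) s@(Y _ ∷ _) (r∈ , inj₂ (s∈ , _)) =
  inj₂ (anchor-InR before M s (InR-mono s ≤-refl (n≤1+n _) s∈) , inj₁ r∈)
anchor-Comparable before M r@(Y _ ∷ _) s@(X _ ∷ _) (r∈ , inj₂ (s∈ , _)) =
  inj₁ (anchor-InR before M r r∈ , inj₁ (InR-mono s ≤-refl (n≤1+n _) s∈))
anchor-Comparable after M r@(X _ ∷ _) s@(Y _ ∷ _) (r∈ , inj₂ (s∈ , _)) =
  inj₁ (anchor-InR after M r r∈ , inj₁ (InR-mono s ≤-refl (n≤1+n _) s∈))
anchor-Comparable after M r@(Y _ ∷ _) s@(X _ ∷ _) (r∈ , inj₂ (s∈ , _)) =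
  inj₂ (anchor-InR after M s (InR-mono s ≤-refl (n≤1+n _) s∈) , inj₁ r∈)

anchor-Comparable-aligned : ∀ {k m n side} {M : Step k} → Aligned side M → ∀ r s → Comparable m (suc n) r s →
  Comparable m (suc (suc n)) (anchor side M r) (anchor side M s)
anchor-Comparable-aligned al r s (r∈ , inj₁ s∈) =
  anchor-InR-aligned al r r∈ , inj₁ (anchor-InR-aligned al s s∈)
anchor-Comparable-aligned al r s (r∈ , inj₂ (s∈ , opp)) =
  anchor-InR-aligned al r r∈ , inj₂ (anchor-InR-aligned al s s∈ , Opposite-anchor-aligned al r s opp)

Equiv-sameOrd : ∀ {k m n} {u v : Word k} → Equiv m n u v → ∀ r s → Comparable m n r s → SameOrd r s u v
Equiv-sameOrd E r@(X _ ∷ _) s@(X _ ∷ _) (r∈ , inj₁ s∈) = Equiv.cond4 E r s (r∈ , tt) (s∈ , tt)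
Equiv-sameOrd E r@(Y _ ∷ _) s@(Y _ ∷ _) (r∈ , inj₁ s∈) = Equiv.cond5 E r s (r∈ , tt) (s∈ , tt)
Equiv-sameOrd {m = m} E r@(X _ ∷ _) s@(Y _ ∷ _) (r∈ , inj₁ s∈) =
  Equiv.cond2 E r s (r∈ , tt) (InR-mono s (m∸n≤m m 1) ≤-refl s∈ , tt)
Equiv-sameOrd {m = m} E r@(Y _ ∷ _) s@(X _ ∷ _) (r∈ , inj₁ s∈) =
  Equiv.cond3 E r s (r∈ , tt) (InR-mono s (m∸n≤m m 1) ≤-refl s∈ , tt)
Equiv-sameOrd E r@(X _ ∷ _) s@(Y _ ∷ _) (r∈ , inj₂ (s∈ , _)) = Equiv.cond2 E r s (r∈ , tt) (s∈ , tt)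
Equiv-sameOrd E r@(Y _ ∷ _) s@(X _ ∷ _) (r∈ , inj₂ (s∈ , _)) = Equiv.cond3 E r s (r∈ , tt) (s∈ , tt)

Equiv-intro : ∀ {k m n} {u v : Word k} → (∀ r → InR m n r → Defined r u ⇔ Defined r v) →
  (∀ r s → Comparable m n r s → SameOrd r s u v) → Equiv m n u v
Equiv-intro {m = m} {n} {u} {v} defined ordered =
  record { cond1 = defined ; cond2 = cond2 ; cond3 = cond3 ; cond4 = cond4 ; cond5 = cond5 }
  where
  cond2 : ∀ r s → InRX m n r → InRY m (n ∸ 1) s → SameOrd r s u v
  cond2 r@(X _ ∷ _) s@(Y _ ∷ _) (r∈ , _) (s∈ , _) = ordered r s (r∈ , inj₂ (s∈ , tt))
  cond3 : ∀ r s → InRY m n r → InRX m (n ∸ 1) s → SameOrd r s u v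
  cond3 r@(Y _ ∷ _) s@(X _ ∷ _) (r∈ , _) (s∈ , _) = ordered r s (r∈ , inj₂ (s∈ , tt))
  cond4 : ∀ r s → InRX m n r → InRX (m ∸ 1) (n ∸ 1) s → SameOrd r s u v
  cond4 r s (r∈ , _) (s∈ , _) = ordered r s (r∈ , inj₁ s∈)
  cond5 : ∀ r s → InRY m n r → InRY (m ∸ 1) (n ∸ 1) s → SameOrd r s u v
  cond5 r s (r∈ , _) (s∈ , _) = ordered r s (r∈ , inj₁ s∈)

SameOrd-swap : ∀ {k} {r s : Ranker k} {u v} → SameOrd r s u v → SameOrd s r u v
SameOrd-swap same {i} {j} {i′} {j′} si rj si′ rj′ =
  trans (ord-swap j i) (trans (cong reverseOrd (same rj si rj′ si′)) (sym (ord-swap j′ i′)))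

Equiv-sym : ∀ {k m n} {u v : Word k} → Equiv m n u v → Equiv m n v u
Equiv-sym E = record
  { cond1 = λ r r∈ → mk⇔ (Equivalence.from (Equiv.cond1 E r r∈)) (Equivalence.to (Equiv.cond1 E r r∈))
  ; cond2 = λ r s r∈ s∈ ri sj ri′ sj′ → sym (Equiv.cond2 E r s r∈ s∈ ri′ sj′ ri sj)
  ; cond3 = λ r s r∈ s∈ ri sj ri′ sj′ → sym (Equiv.cond3 E r s r∈ s∈ ri′ sj′ ri sj)
  ; cond4 = λ r s r∈ s∈ ri sj ri′ sj′ → sym (Equiv.cond4 E r s r∈ s∈ ri′ sj′ ri sj)
  ; cond5 = λ r s r∈ s∈ ri sj ri′ sj′ → sym (Equiv.cond5 E r s r∈ s∈ ri′ sj′ ri sj)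
  }

-- Transport along ≡_{m,n}

module _ {k m n} {u v : Word k} {P Q : ℕ → Set}
  (transport : ∀ ρ → InR m n ρ → ∀ {y} → eval ρ u ≡ just y → P y → ∃ λ y′ → eval ρ v ≡ just y′ × Q y′)
  where

  Within-transport : ∀ h pre zs {x x′} → eval (h ∷ pre) u ≡ just x → eval (h ∷ pre) v ≡ just x′ →
    InR m n (h ∷ pre ++ zs) → Within P zs u x → Within Q zs v x′
  Within-transport h pre []       ex ex′ ρ∈ _ = tt
  Within-transport h pre (z ∷ zs) ex ex′ ρ∈ (y , ey , py , within)
    with transport (h ∷ pre ++ z ∷ []) (InR-prefix h (pre ++ z ∷ []) zs (InR-reassoc h pre z zs ρ∈))
                   (trans (eval-snoc h pre z u ex) ey) py
  ... | y′ , ey′ , qy′ =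
    y′ , trans (sym (eval-snoc h pre z v ex′)) ey′ , qy′ ,
    Within-transport h (pre ++ z ∷ []) zs (trans (eval-snoc h pre z u ex) ey) ey′ (InR-reassoc h pre z zs ρ∈) within

  Within-transport-start : ∀ z zs → InR m n (z ∷ zs) →
    Within P (z ∷ zs) u (startPos z u) → Within Q (z ∷ zs) v (startPos z v)
  Within-transport-start z zs ρ∈ (y , ey , py , within)
    with transport (z ∷ []) (InR-prefix z [] zs ρ∈) (trans (runFrom-single z u _) ey) py
  ... | y′ , ey′ , qy′ =
    y′ , trans (sym (runFrom-single z v _)) ey′ , qy′ ,
    Within-transport z [] zs (trans (runFrom-single z u _) ey) ey′ ρ∈ within

module _ {k m n} {u v : Word k} (E : Equiv m n u v) {M : Step k} (M∈ : InR (m ∸ 1) (n ∸ 1) (M ∷ []))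
  {p q : ℕ} (Mu : eval (M ∷ []) u ≡ just p) (Mv : eval (M ∷ []) v ≡ just q)
  where

  OnSide-transport : ∀ side ρ → InR m n ρ → ∀ {y} → eval ρ u ≡ just y → OnSide side p y →
    ∃ λ y′ → eval ρ v ≡ just y′ × OnSide side q y′
  OnSide-transport side ρ ρ∈ {y} ρu on with Equivalence.to (Equiv.cond1 E ρ ρ∈) (y , ρu)
  ... | y′ , ρv = y′ , ρv , trans (sym (Equiv-sameOrd E ρ (M ∷ []) (ρ∈ , inj₁ M∈) ρu Mu ρv Mv)) on

  Stays-transport : ∀ side r → InR m n (anchor side M r) → Stays side p u r → Stays side q v r
  Stays-transport before (X b ∷ zs) = Within-transport-start (OnSide-transport before) (X b) zs
  Stays-transport before (Y b ∷ zs) = Within-transport (OnSide-transport before) M [] (Y b ∷ zs) Mu Mv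
  Stays-transport after  (X b ∷ zs) = Within-transport (OnSide-transport after) M [] (X b ∷ zs) Mu Mv
  Stays-transport after  (Y b ∷ zs) = Within-transport-start (OnSide-transport after) (Y b) zs

window-equiv : ∀ {k m n m′ n′ side} {M : Step k} {u v w w′} → Equiv m n u v → InR (m ∸ 1) (n ∸ 1) (M ∷ []) →
  Window side M u w → Window side M v w′ →
  (∀ r → InR m′ n′ r → InR m n (anchor side M r)) →
  (∀ r s → Comparable m′ n′ r s → SameOrd (anchor side M r) (anchor side M s) u v) →
  Equiv m′ n′ w w′
window-equiv {m′ = m′} {n′} {side} {w = w} {w′} E M∈ Wu Wv anchor∈ anchor-ordered = Equiv-intro defined ordered
  where
  module U = Window Wu
  module V = Window Wv

  defined : ∀ r → InR m′ n′ r → Defined r w ⇔ Defined r w′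
  defined r r∈ = mk⇔
    (λ { (_ , e) → V.restrict r (Stays-transport E M∈ U.mark-eval V.mark-eval side r (anchor∈ r r∈) (proj₁ (U.embed r e))) })
    (λ { (_ , e) → U.restrict r (Stays-transport (Equiv-sym E) M∈ V.mark-eval U.mark-eval side r (anchor∈ r r∈) (proj₁ (V.embed r e))) })

  ordered : ∀ r s → Comparable m′ n′ r s → SameOrd r s w w′
  ordered r s rs {i} {j} {i′} {j′} ri sj ri′ sj′ = begin
    ord i j                             ≡⟨ ord-+ U.offset i j ⟨
    ord (U.offset + i) (U.offset + j)   ≡⟨ anchor-ordered r s rs (proj₂ (U.embed r ri)) (proj₂ (U.embed s sj))
                                                                 (proj₂ (V.embed r ri′)) (proj₂ (V.embed s sj′)) ⟩
    ord (V.offset + i′) (V.offset + j′) ≡⟨ ord-+ V.offset i′ j′ ⟩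
    ord i′ j′                           ∎
    where open ≡-Reasoning

marker-InR : ∀ {k m n} (M : Step k) → InR (suc m) (suc n) (M ∷ [])
marker-InR M = s≤s z≤n , s≤s z≤n

shallow-window-equiv : ∀ {k m n side} {M : Step k} {u v w w′} → Equiv (suc (suc m)) (suc (suc n)) u v →
  Window side M u w → Window side M v w′ → Equiv (suc m) (suc n) w w′
shallow-window-equiv {side = side} {M} {u} {v} E Wu Wv =
  window-equiv E (marker-InR M) Wu Wv (anchor-InR side M) ordered
  where
  ordered : ∀ r s → Comparable _ _ r s → SameOrd (anchor side M r) (anchor side M s) u v
  ordered r s rs with anchor-Comparable side M r s rs
  ... | inj₁ rs′ = Equiv-sameOrd E _ _ rs′
  ... | inj₂ sr′ = SameOrd-swap {r = anchor side M s} {anchor side M r} {u} {v} (Equiv-sameOrd E _ _ sr′)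

aligned-window-equiv : ∀ {k m n side} {M : Step k} {u v w w′} → Aligned side M → Equiv (suc (suc m)) (suc (suc n)) u v →
  Window side M u w → Window side M v w′ → Equiv (suc (suc m)) (suc n) w w′
aligned-window-equiv {M = M} al E Wu Wv =
  window-equiv E (marker-InR M) Wu Wv (anchor-InR-aligned al)
    (λ r s rs → Equiv-sameOrd E _ _ (anchor-Comparable-aligned al r s rs))

-- The a-factorizations

Xpos-head : ∀ {k} (a : Fin k) t → Xpos a (a ∷ t) 0 ≡ just 1
Xpos-head a t with a ≟ a
... | yes _   = refl
... | no a≢a = contradiction refl a≢a

X-first : ∀ {k} (a : Fin k) w t → a ∉ w → eval (X a ∷ []) (w ++ a ∷ t) ≡ just (suc (length w))
X-first a w t a∉w = begin
  eval (X a ∷ []) (w ++ a ∷ t)                                        ≡⟨ runFrom-single (X a) (w ++ a ∷ t) 0 ⟩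
  Xpos a (w ++ a ∷ t) 0                                               ≡⟨ Xpos-++ w (a ∷ t) a 0 ⟩
  (Xpos a w 0 <∣> map (length w +_) (Xpos a (a ∷ t) (0 ∸ length w)))  ≡⟨ cong₂ _<∣>_ (nextFrom-∉ w a 1 0 a∉w)
                                                                           (cong (λ x → map (length w +_) (Xpos a (a ∷ t) x)) (0∸n≡0 (length w))) ⟩
  map (length w +_) (Xpos a (a ∷ t) 0)                                ≡⟨ cong (map (length w +_)) (Xpos-head a t) ⟩
  just (length w + 1)                                                 ≡⟨ cong just (+-comm (length w) 1) ⟩
  just (suc (length w))                                               ∎
  where open ≡-Reasoning

Y-last : ∀ {k} (a : Fin k) w t → a ∉ t → eval (Y a ∷ []) (w ++ a ∷ t) ≡ just (suc (length w))
Y-last a w t a∉t = begin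
  eval (Y a ∷ []) (w ++ a ∷ t)                        ≡⟨ runFrom-single (Y a) (w ++ a ∷ t) end ⟩
  prevFrom (w ++ a ∷ t) a 1 end nothing               ≡⟨ prevFrom-++ w (a ∷ t) a 1 end nothing ⟩
  prevFrom (a ∷ t) a (length w + 1) end (Ypos a w end) ≡⟨ prevFrom-∉ t a _ end _ a∉t ⟩
  (if (length w + 1 <ᵇ end) ∧ ⌊ a ≟ a ⌋ then just (length w + 1) else Ypos a w end)
                                                      ≡⟨ hit ⟩
  just (length w + 1)                                 ≡⟨ cong just (+-comm (length w) 1) ⟩
  just (suc (length w))                               ∎
  where
  open ≡-Reasoning
  end = suc (length (w ++ a ∷ t))

  marker<end : length w + 1 < end
  marker<end = s≤s (subst (length w + 1 ≤_) (sym (length-++ w)) (+-monoʳ-≤ (length w) (s≤s z≤n)))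

  hit : (if (length w + 1 <ᵇ end) ∧ ⌊ a ≟ a ⌋ then just (length w + 1) else Ypos a w end) ≡ just (length w + 1)
  hit rewrite Equivalence.to T-≡ (<⇒<ᵇ marker<end) with a ≟ a
  ... | yes _   = refl
  ... | no a≢a = contradiction refl a≢a

lemma4 : ∀ {k : ℕ} (m n : ℕ) → 2 ≤ m → 2 ≤ n → (a : Fin k) (u v : Word k) → Equiv m n u v →
    (∀ (u₋ u₊ v₋ v₊ : Word k) → u ≡ u₋ ++ (a ∷ u₊) → v ≡ v₋ ++ (a ∷ v₊) → a ∉ u₋ → a ∉ v₋ →
      Equiv (m ∸ 1) (n ∸ 1) u₋ v₋ × Equiv m (n ∸ 1) u₊ v₊)
    × (∀ (u₋ u₊ v₋ v₊ : Word k) → u ≡ u₋ ++ (a ∷ u₊) → v ≡ v₋ ++ (a ∷ v₊) → a ∉ u₊ → a ∉ v₊ →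
      Equiv (m ∸ 1) (n ∸ 1) u₊ v₊ × Equiv m (n ∸ 1) u₋ v₋)
lemma4 (suc (suc m)) (suc (suc n)) (s≤s (s≤s z≤n)) (s≤s (s≤s z≤n)) a u v E =
  (λ u₋ u₊ v₋ v₊ u≡ v≡ a∉u₋ a∉v₋ →
    let E′ = subst₂ (Equiv _ _) u≡ v≡ E
        Xu = X-first a u₋ u₊ a∉u₋
        Xv = X-first a v₋ v₊ a∉v₋
    in shallow-window-equiv E′ (prefix-window (X a) u₋ (a ∷ u₊) Xu) (prefix-window (X a) v₋ (a ∷ v₊) Xv) ,
       aligned-window-equiv (after-X a) E′ (suffix-window-∷ (X a) u₋ a u₊ Xu) (suffix-window-∷ (X a) v₋ a v₊ Xv)) ,
  (λ u₋ u₊ v₋ v₊ u≡ v≡ a∉u₊ a∉v₊ →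
    let E′ = subst₂ (Equiv _ _) u≡ v≡ E
        Yu = Y-last a u₋ u₊ a∉u₊
        Yv = Y-last a v₋ v₊ a∉v₊
    in shallow-window-equiv E′ (suffix-window-∷ (Y a) u₋ a u₊ Yu) (suffix-window-∷ (Y a) v₋ a v₊ Yv) ,
       aligned-window-equiv (before-Y a) E′ (prefix-window (Y a) u₋ (a ∷ u₊) Yu) (prefix-window (Y a) v₋ (a ∷ v₊) Yv))
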